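{- Let $G$ be a finite simple connected graph on $n+s$ vertices and let $S\subseteq V(G)$ with $|S|=s\geq 1$. If each non-terminal level with respect to $S$ contains at least $3$ vertices, then \[ \sigma(S)\leq \frac{1}{6}(n^2+3n+2). \]
   Context: For $u\in V(G)$, $d_G(S,u)=\min\{d_G(u,v): v\in S\}$, where $d_G$ is the graph distance. The status of $S$ is $\sigma(S)=\sigma_G(S)=\sum_{u\in V(G)} d_G(S,u)$. For $i\geq 1$, the $i$-th level with respect to $S$ is the set of vertices at distance exactly $i$ from $S$; the terminal level is the farthest (largest $i$) nonempty level, and the non-terminal levels are the nonempty levels $i\geq 1$ other than the terminal one. -}

module Defs where

open import Data.Nat using (ℕ; zero; suc; _+_; _*_; _≤_; _<_; _≟_)
open import Data.Bool using (Bool; true; false; T)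
open import Data.Fin using (Fin)
open import Data.Fin.Subset using (Subset; _∈_)
open import Data.List using (List; length; filter; map; allFin)
open import Data.Nat.ListAction using (sum)
open import Data.Product using (Σ; ∃; _×_; _,_)
open import Relation.Binary.PropositionalEquality using (_≡_)
open import Relation.Nullary using (¬_)

record Graph (N : ℕ) : Set where
  field
    adj     : Fin N → Fin N → Bool
    sym     : ∀ u v → adj u v ≡ adj v u
    irrefl  : ∀ u → adj u u ≡ false

module _ {N : ℕ} (G : Graph N) where
  open Graph G

  data Walk : ℕ → Fin N → Fin N → Set where
    here : ∀ {u} → Walk zero u u
    step : ∀ {k u v w} → T (adj u v) → Walk k v w → Walk (suc k) u w

  Connected : Set
  Connected = ∀ u v → ∃ λ k → Walk k u v

  IsDist : Fin N → Fin N → ℕ → Set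
  IsDist u v k = Walk k u v × (∀ m → Walk m u v → k ≤ m)

  IsDistToSet : Subset N → Fin N → ℕ → Set
  IsDistToSet S u k =
    (Σ (Fin N) λ v → v ∈ S × IsDist u v k) ×
    (∀ v m → v ∈ S → IsDist u v m → k ≤ m)

levelSize : ∀ {N} → (Fin N → ℕ) → ℕ → ℕ
levelSize {N} d i = length (filter (λ u → d u ≟ i) (allFin N))

LevelNonempty : ∀ {N} → (Fin N → ℕ) → ℕ → Set
LevelNonempty {N} d i = Σ (Fin N) λ u → d u ≡ i

NonTerminal : ∀ {N} → (Fin N → ℕ) → ℕ → Set
NonTerminal d i = 1 ≤ i × LevelNonempty d i × (Σ ℕ λ j → i < j × LevelNonempty d j)

status : ∀ {N} → (Fin N → ℕ) → ℕ
status {N} d = sum (map d (allFin N))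

-- Shifting every distance down by one splits the status as
--   σ = (number of vertices outside S) + (status of the shifted profile),
-- and the shifted profile has fewer vertices outside S, by the size of level 1.
-- Unless level 1 is terminal it has at least three vertices, so by induction
-- σ ≤ maxStatus n, where maxStatus m = m + maxStatus (m − 3) is the status of the
-- profile with levels of sizes 3, 3, …, 3 followed by one level of size at most 3;
-- and 6 maxStatus n ≤ n² + 3n + 2.
-- Only two graph facts are used: d u = 0 exactly on S, and below every nonempty
-- level all levels are nonempty.
module Submission where

open import Algebra.Properties.CommutativeSemigroup using (x∙yz≈y∙xz)
open import Data.Fin using (Fin)
import Data.Fin as Fin
open import Data.Fin.Properties using (any?)
open import Data.Fin.Subset using (Subset; ∣_∣; _∈_; inside; outside)
open import Data.Fin.Subset.Properties using (drop-there)
open import Data.List using (List; []; _∷_; length; filter; map; tabulate; allFin)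
open import Data.List.Membership.Propositional using () renaming (_∈_ to _∈ˡ_)
open import Data.List.Membership.Propositional.Properties using (∈-map⁻)
open import Data.List.Properties using (length-map; length-tabulate; map-tabulate)
open import Data.List.Relation.Unary.Any using (here; there)
open import Data.Nat
  using (ℕ; zero; suc; pred; _+_; _*_; _≤_; _<_; _≟_; _≤?_; z≤n; s≤s; s≤s⁻¹;
         _≤′_; ≤′-refl; ≤′-step; anyUpTo?)
open import Data.Nat.Induction using (<-wellFounded; <-rec)
open import Data.Nat.ListAction using (sum)
open import Data.Nat.Properties
open import Data.Product using (∃; _×_; _,_; proj₁; proj₂)
open import Data.Vec using (here; there) renaming (_∷_ to _∷ᵥ_; [] to []ᵥ)
open import Function using (id; _∘_)
open import Level using (Level)
open import Induction.WellFounded using (module All)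
open import Relation.Binary.Construct.On using (wellFounded)
open import Relation.Binary.PropositionalEquality
open import Relation.Nullary using (Dec; yes; no; contradiction)
open import Relation.Nullary.Decidable using (T?; map′; _×-dec_)
open import Relation.Unary using (Pred; Decidable; _≐_)

open import Defs

count : ∀ {a p} {A : Set a} {P : Pred A p} → Decidable P → List A → ℕ
count P? = length ∘ filter P?

module _ {a} {A : Set a} where

  count-map : ∀ {b p} {B : Set b} {P : Pred B p} (P? : Decidable P) (f : A → B) (xs : List A) →
              count P? (map f xs) ≡ count (P? ∘ f) xs
  count-map P? f [] = refl
  count-map P? f (x ∷ xs) with P? (f x)
  ... | yes _ = cong suc (count-map P? f xs)
  ... | no _  = count-map P? f xs

  count-≐ : ∀ {p q} {P : Pred A p} {Q : Pred A q} (P? : Decidable P) (Q? : Decidable Q) →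
            P ≐ Q → (xs : List A) → count P? xs ≡ count Q? xs
  count-≐ P? Q? P≐Q [] = refl
  count-≐ P? Q? P≐Q (x ∷ xs) with P? x | Q? x
  ... | yes _  | yes _  = cong suc (count-≐ P? Q? P≐Q xs)
  ... | no _   | no _   = count-≐ P? Q? P≐Q xs
  ... | yes px | no ¬qx = contradiction (proj₁ P≐Q px) ¬qx
  ... | no ¬px | yes qx = contradiction (proj₂ P≐Q qx) ¬px

module _ {a p : Level} {A : Set a} {P : Pred A p} where

  ≐-tail : ∀ {n x} {S : Subset n} {g : Fin (suc n) → A} →
           (P ∘ g) ≐ (_∈ x ∷ᵥ S) → (P ∘ g ∘ Fin.suc) ≐ (_∈ S)
  ≐-tail (P∘g⊆S , S⊆P∘g) = drop-there ∘ P∘g⊆S , S⊆P∘g ∘ there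

  ∣S∣≡count-tabulate : (P? : Decidable P) → ∀ {n} (S : Subset n) (g : Fin n → A) →
                       (P ∘ g) ≐ (_∈ S) → ∣ S ∣ ≡ count P? (tabulate g)
  ∣S∣≡count-tabulate P? []ᵥ g _ = refl
  ∣S∣≡count-tabulate P? (x ∷ᵥ S) g P∘g≐S with x | P? (g Fin.zero)
  ... | inside  | yes _   = cong suc (∣S∣≡count-tabulate P? S (g ∘ Fin.suc) (≐-tail P∘g≐S))
  ... | outside | no _    = ∣S∣≡count-tabulate P? S (g ∘ Fin.suc) (≐-tail P∘g≐S)
  ... | inside  | no ¬pg₀ = contradiction (proj₂ P∘g≐S here) ¬pg₀
  ... | outside | yes pg₀ with () ← proj₁ P∘g≐S pg₀

-- Distance profiles: the list of the distances d(S, u) of all vertices u.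

level : ℕ → List ℕ → ℕ
level i = count (_≟ i)

#positive : List ℕ → ℕ
#positive = count (1 ≤?_)

ThickLevels : List ℕ → Set
ThickLevels ds = ∀ {i j} → 1 ≤ i → i < j → j ∈ˡ ds → 3 ≤ level i ds

sum≡#positive+sum∘pred : ∀ ds → sum ds ≡ #positive ds + sum (map pred ds)
sum≡#positive+sum∘pred [] = refl
sum≡#positive+sum∘pred (zero ∷ ds) = sum≡#positive+sum∘pred ds
sum≡#positive+sum∘pred (suc d ∷ ds) = cong suc (begin
  d + sum ds                               ≡⟨ cong (d +_) (sum≡#positive+sum∘pred ds) ⟩
  d + (#positive ds + sum (map pred ds))   ≡⟨ x∙yz≈y∙xz +-commutativeSemigroup d (#positive ds) _ ⟩
  #positive ds + (d + sum (map pred ds))   ∎)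
  where open ≡-Reasoning

#positive≡level₁+#positive∘pred : ∀ ds → #positive ds ≡ level 1 ds + #positive (map pred ds)
#positive≡level₁+#positive∘pred [] = refl
#positive≡level₁+#positive∘pred (zero ∷ ds) = #positive≡level₁+#positive∘pred ds
#positive≡level₁+#positive∘pred (suc zero ∷ ds) = cong suc (#positive≡level₁+#positive∘pred ds)
#positive≡level₁+#positive∘pred (suc (suc d) ∷ ds) =
  trans (cong suc (#positive≡level₁+#positive∘pred ds)) (sym (+-suc (level 1 ds) _))

level∘pred : ∀ i ds → level (suc i) (map pred ds) ≡ level (suc (suc i)) ds
level∘pred i ds = trans (count-map (_≟ suc i) pred ds)
  (count-≐ ((_≟ suc i) ∘ pred) (_≟ suc (suc i)) ((λ { {suc _} refl → refl }) , (λ { refl → refl })) ds)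

level₀+#positive≡length : ∀ ds → level 0 ds + #positive ds ≡ length ds
level₀+#positive≡length [] = refl
level₀+#positive≡length (zero ∷ ds) = cong suc (level₀+#positive≡length ds)
level₀+#positive≡length (suc d ∷ ds) =
  trans (+-suc (level 0 ds) _) (cong suc (level₀+#positive≡length ds))

#positive≡0⇒sum≡0 : ∀ ds → #positive ds ≡ 0 → sum ds ≡ 0
#positive≡0⇒sum≡0 [] _ = refl
#positive≡0⇒sum≡0 (zero ∷ ds) eq = #positive≡0⇒sum≡0 ds eq

positive-∈ : ∀ ds → 1 ≤ #positive ds → ∃ λ j → 1 ≤ j × j ∈ˡ ds
positive-∈ (zero ∷ ds) p with positive-∈ ds p
... | j , 1≤j , j∈ds = j , 1≤j , there j∈ds
positive-∈ (suc d ∷ ds) _ = suc d , s≤s z≤n , here refl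

suc∈map-pred : ∀ {j ds} → suc j ∈ˡ map pred ds → suc (suc j) ∈ˡ ds
suc∈map-pred j∈ with ∈-map⁻ pred j∈
... | suc (suc _) , x∈ds , refl = x∈ds

ThickLevels-pred : ∀ {ds} → ThickLevels ds → ThickLevels (map pred ds)
ThickLevels-pred {ds} thick {suc i} {suc j} _ i<j j∈ =
  subst (3 ≤_) (sym (level∘pred i ds)) (thick (s≤s z≤n) (s≤s i<j) (suc∈map-pred j∈))

ThickLevels⇒3≤level₁ : ∀ {ds} → ThickLevels ds → 1 ≤ #positive (map pred ds) → 3 ≤ level 1 ds
ThickLevels⇒3≤level₁ {ds} thick 1≤#positive with positive-∈ (map pred ds) 1≤#positive
... | suc j , _ , j∈ = thick ≤-refl (s≤s (s≤s z≤n)) (suc∈map-pred j∈)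

maxStatus : ℕ → ℕ
maxStatus 0 = 0
maxStatus 1 = 1
maxStatus 2 = 2
maxStatus (suc (suc (suc m))) = 3 + m + maxStatus m

maxStatus-suc : ∀ m → maxStatus m ≤ maxStatus (suc m)
maxStatus-suc 0 = z≤n
maxStatus-suc 1 = s≤s z≤n
maxStatus-suc 2 = s≤s (s≤s z≤n)
maxStatus-suc (suc (suc (suc m))) = +-mono-≤ (s≤s (s≤s (s≤s (n≤1+n m)))) (maxStatus-suc m)

maxStatus-mono : ∀ {m n} → m ≤ n → maxStatus m ≤ maxStatus n
maxStatus-mono = go ∘ ≤⇒≤′
  where
  go : ∀ {m n} → m ≤′ n → maxStatus m ≤ maxStatus n
  go ≤′-refl = ≤-refl
  go {n = suc n} (≤′-step m≤′n) = ≤-trans (go m≤′n) (maxStatus-suc n)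

m≤maxStatus : ∀ m → m ≤ maxStatus m
m≤maxStatus 0 = z≤n
m≤maxStatus 1 = ≤-refl
m≤maxStatus 2 = ≤-refl
m≤maxStatus (suc (suc (suc m))) = m≤m+n (3 + m) (maxStatus m)

maxStatus-step : ∀ l m → 3 ≤ l → l + m + maxStatus m ≤ maxStatus (l + m)
maxStatus-step (suc (suc (suc l))) m (s≤s (s≤s (s≤s z≤n))) =
  +-monoʳ-≤ (3 + l + m) (maxStatus-mono (m≤n+m m l))

6*maxStatus≤ : ∀ m → 6 * maxStatus m ≤ m * m + 3 * m + 2
6*maxStatus≤ 0 = z≤n
6*maxStatus≤ 1 = ≤-refl
6*maxStatus≤ 2 = ≤-refl
6*maxStatus≤ (suc (suc (suc m))) = begin
  6 * (3 + m + maxStatus m)           ≡⟨ *-distribˡ-+ 6 (3 + m) (maxStatus m) ⟩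
  6 * (3 + m) + 6 * maxStatus m       ≤⟨ +-monoʳ-≤ (6 * (3 + m)) (6*maxStatus≤ m) ⟩
  6 * (3 + m) + (m * m + 3 * m + 2)   ≡⟨ expand m ⟩
  (3 + m) * (3 + m) + 3 * (3 + m) + 2 ∎
  where
  open ≤-Reasoning
  open import Data.Nat.Tactic.RingSolver using (solve-∀)
  expand : ∀ m → 6 * (3 + m) + (m * m + 3 * m + 2) ≡ (3 + m) * (3 + m) + 3 * (3 + m) + 2
  expand = solve-∀

sum≤maxStatus∘#positive : ∀ ds → ThickLevels ds → sum ds ≤ maxStatus (#positive ds)
sum≤maxStatus∘#positive = All.wfRec (wellFounded #positive <-wellFounded) _ _ peel-level₁
  where
  peel-level₁ : ∀ ds →
                (∀ {es} → #positive es < #positive ds → ThickLevels es → sum es ≤ maxStatus (#positive es)) →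
                ThickLevels ds → sum ds ≤ maxStatus (#positive ds)
  peel-level₁ ds rec thick with #positive (map pred ds) in eq
  ... | zero = begin
    sum ds                             ≡⟨ sum≡#positive+sum∘pred ds ⟩
    #positive ds + sum (map pred ds)   ≡⟨ cong (#positive ds +_) (#positive≡0⇒sum≡0 (map pred ds) eq) ⟩
    #positive ds + 0                   ≡⟨ +-identityʳ _ ⟩
    #positive ds                       ≤⟨ m≤maxStatus _ ⟩
    maxStatus (#positive ds)           ∎
    where open ≤-Reasoning
  ... | suc _ = begin
    sum ds                                          ≡⟨ sum≡#positive+sum∘pred ds ⟩
    #positive ds + sum (map pred ds)                ≤⟨ +-monoʳ-≤ (#positive ds) (rec shrinks (ThickLevels-pred thick)) ⟩
    #positive ds + maxStatus #positive′             ≡⟨ cong (_+ maxStatus #positive′) split ⟩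
    level 1 ds + #positive′ + maxStatus #positive′  ≤⟨ maxStatus-step _ _ 3≤level₁ ⟩
    maxStatus (level 1 ds + #positive′)             ≡⟨ cong maxStatus split ⟨
    maxStatus (#positive ds)                        ∎
    where
    open ≤-Reasoning
    #positive′ : ℕ
    #positive′ = #positive (map pred ds)
    split : #positive ds ≡ level 1 ds + #positive′
    split = #positive≡level₁+#positive∘pred ds
    3≤level₁ : 3 ≤ level 1 ds
    3≤level₁ = ThickLevels⇒3≤level₁ thick (subst (1 ≤_) (sym eq) (s≤s z≤n))
    shrinks : #positive′ < #positive ds
    shrinks = subst (#positive′ <_) (sym split) (m<n+m _ (≤-trans (s≤s z≤n) 3≤level₁))

LeastBelow : ∀ {p} → Pred ℕ p → ℕ → Set p
LeastBelow P m = ∃ λ k → k ≤ m × P k × (∀ j → P j → k ≤ j)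

least : ∀ {p} {P : Pred ℕ p} → Decidable P → ∀ {m} → P m → LeastBelow P m
least {P = P} P? {m} = <-rec (λ m → P m → LeastBelow P m) descend m
  where
  descend : ∀ m → (∀ {k} → k < m → P k → LeastBelow P k) → P m → LeastBelow P m
  descend m rec pm with anyUpTo? P? m
  ... | yes (k , k<m , pk) with rec k<m pk
  ...   | l , l≤k , pl , minimal = l , ≤-trans l≤k (<⇒≤ k<m) , pl , minimal
  descend m rec pm | no none = m , ≤-refl , pm , λ j pj → ≮⇒≥ (λ j<m → none (j , j<m , pj))

module Walks {N} (G : Graph N) where
  open Graph G using (adj)

  walk? : ∀ k x v → Dec (Walk G k x v)
  walk? zero x v with x Fin.≟ v
  ... | yes refl = yes here
  ... | no x≢v   = no λ { here → x≢v refl }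
  walk? (suc k) x v =
    map′ (λ (w , x~w , walk) → step x~w walk) (λ { (step x~w walk) → _ , x~w , walk })
         (any? λ w → T? (adj x w) ×-dec walk? k w v)

  shortest : ∀ {m x v} → Walk G m x v → ∃ λ k → k ≤ m × IsDist G x v k
  shortest {x = x} {v} = least (λ k → walk? k x v)

module Distances {N} (G : Graph N) (S : Subset N) (d : Fin N → ℕ)
                 (isDist : ∀ u → IsDistToSet G S u (d u)) where
  open Walks G

  d≤walk-length : ∀ {m x v} → v ∈ S → Walk G m x v → d x ≤ m
  d≤walk-length v∈S walk with shortest walk
  ... | k , k≤m , dist = ≤-trans (proj₂ (isDist _) _ k v∈S dist) k≤m

  d-predecessor : ∀ {m} u → d u ≡ suc m → ∃ λ w → d w ≡ m
  d-predecessor u du≡1+m with isDist u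
  ... | (v , v∈S , walk , _) , _ with subst (λ k → Walk G k u v) du≡1+m walk
  ...   | step {v = w} u~w walk′ with isDist w
  ...     | (v′ , v′∈S , walk″ , _) , _ =
    w , ≤-antisym (d≤walk-length v∈S walk′)
                  (s≤s⁻¹ (subst (_≤ suc (d w)) du≡1+m (d≤walk-length v′∈S (step u~w walk″))))

  level-nonempty-below : ∀ {i} u → i ≤ d u → LevelNonempty d i
  level-nonempty-below u = go u refl ∘ ≤⇒≤′
    where
    go : ∀ {i k} u → d u ≡ k → i ≤′ k → LevelNonempty d i
    go u du≡k ≤′-refl = u , du≡k
    go u du≡1+k (≤′-step i≤′k) with d-predecessor u du≡1+k
    ... | w , dw≡k = go w dw≡k i≤′k

  d≡0≐∈S : (λ u → d u ≡ 0) ≐ (_∈ S)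
  d≡0≐∈S = d≡0⇒∈S , λ u∈S → n≤0⇒n≡0 (proj₂ (isDist _) _ 0 u∈S (here , λ _ _ → z≤n))
    where
    d≡0⇒∈S : ∀ {u} → d u ≡ 0 → u ∈ S
    d≡0⇒∈S {u} du≡0 with isDist u
    ... | (v , v∈S , walk , _) , _ with subst (λ k → Walk G k u v) du≡0 walk
    ...   | here = v∈S

  profile : List ℕ
  profile = map d (allFin N)

  #positive+∣S∣≡N : #positive profile + ∣ S ∣ ≡ N
  #positive+∣S∣≡N = begin
    #positive profile + ∣ S ∣             ≡⟨ cong (#positive profile +_) ∣S∣≡level₀ ⟩
    #positive profile + level 0 profile   ≡⟨ +-comm (#positive profile) _ ⟩
    level 0 profile + #positive profile   ≡⟨ level₀+#positive≡length profile ⟩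
    length profile                        ≡⟨ length-map d (allFin N) ⟩
    length (allFin N)                     ≡⟨ length-tabulate id ⟩
    N                                     ∎
    where
    open ≡-Reasoning
    ∣S∣≡level₀ : ∣ S ∣ ≡ level 0 profile
    ∣S∣≡level₀ = trans (∣S∣≡count-tabulate (_≟ 0) S d d≡0≐∈S)
                       (cong (level 0) (sym (map-tabulate id d)))

  thickLevels : (∀ i → NonTerminal d i → 3 ≤ levelSize d i) → ThickLevels profile
  thickLevels nonTerminal≥3 {i} 1≤i i<j j∈profile with ∈-map⁻ d j∈profile
  ... | u , _ , refl = subst (3 ≤_) (sym (count-map (_≟ i) d (allFin N)))
    (nonTerminal≥3 i (1≤i , level-nonempty-below u (<⇒≤ i<j) , d u , i<j , u , refl))

lemma5 : (n s : ℕ) → (G : Graph (n + s)) → Connected G →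
         (S : Subset (n + s)) → ∣ S ∣ ≡ s → 1 ≤ s →
         (d : Fin (n + s) → ℕ) → (∀ u → IsDistToSet G S u (d u)) →
         (∀ i → NonTerminal d i → 3 ≤ levelSize d i) →
         6 * status d ≤ n * n + 3 * n + 2
lemma5 n s G _ S ∣S∣≡s _ d isDist nonTerminal≥3 = begin
  6 * status d                        ≤⟨ *-monoʳ-≤ 6 (sum≤maxStatus∘#positive profile (thickLevels nonTerminal≥3)) ⟩
  6 * maxStatus (#positive profile)   ≡⟨ cong (λ m → 6 * maxStatus m) #positive≡n ⟩
  6 * maxStatus n                     ≤⟨ 6*maxStatus≤ n ⟩
  n * n + 3 * n + 2                   ∎
  where
  open Distances G S d isDist
  open ≤-Reasoning
  #positive≡n : #positive profile ≡ n
  #positive≡n = +-cancelʳ-≡ s (#positive profile) n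
                  (subst (λ t → #positive profile + t ≡ n + s) ∣S∣≡s #positive+∣S∣≡N)
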